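{- For every $r\ge 2$, the glued binary tree $GT(r)$ satisfies $\mu_{\rm o}(GT(r))=2^r$, and $GT(r)$ has exactly one $\mu_{\rm o}$-set (outer mutual-visibility set of maximum size).
   Context: A perfect binary tree of depth $r$ is a rooted tree in which every non-leaf vertex has exactly 2 children and all leaves have depth $r$. $GT(r)$ is obtained from two copies of it by identifying each leaf of the first copy with the corresponding leaf (under the natural isomorphism) of the second copy. For a graph $G$ and $S\subseteq V(G)$, two vertices $u,v$ are $S$-visible if there exists a shortest $u,v$-path $P$ with $V(P)\cap S\subseteq\{u,v\}$. $S$ is a mutual-visibility set if every two vertices of $S$ are $S$-visible; $S$ is an outer mutual-visibility set if it is a mutual-visibility set and every pair $u\in S$, $v\in V(G)\setminus S$ is $S$-visible. $\mu_{\rm o}(G)$ is the maximum size of an outer mutual-visibility set, and a $\mu_{\rm o}$-set is one of that size. -}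

module Defs where

open import Data.Nat using (ℕ; zero; suc; _≤_; _<_)
open import Data.Bool using (Bool)
open import Data.List using (List; []; _∷_; length)
open import Data.Vec using (Vec; toList)
open import Data.Product using (Σ; _×_; _,_)
open import Data.Sum using (_⊎_)
open import Data.List.Relation.Unary.All using (All)
open import Data.List.Relation.Unary.Unique.Propositional using (Unique)
open import Data.List.Membership.Propositional using (_∈_; _∉_)
open import Relation.Binary.PropositionalEquality using (_≡_)
open import Function.Bundles using (_⇔_)

-- General (simple, undirected) graphs given by an adjacency relation
-- on a vertex type V.  Vertex subsets are duplicate-free lists.

module GraphNotions {V : Set} (Adj : V → V → Set) where

  data Walk : V → V → Set where
    []  : ∀ {u} → Walk u u
    _∷_ : ∀ {u w v} → Adj u w → Walk w v → Walk u v

  len : ∀ {u v} → Walk u v → ℕ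
  len []      = 0
  len (_ ∷ p) = suc (len p)

  interior : ∀ {u v} → Walk u v → List V
  interior []                   = []
  interior (_ ∷ [])             = []
  interior (_∷_ {w = w} _ (e ∷ p)) = w ∷ interior (e ∷ p)

  -- a shortest u,v-path (a walk of minimum length; such walks are paths)
  IsShortest : ∀ {u v} → Walk u v → Set
  IsShortest {u} {v} p = (q : Walk u v) → len p ≤ len q

  Visible : List V → V → V → Set
  Visible S u v =
    Σ (Walk u v) λ p → IsShortest p × All (λ x → x ∉ S) (interior p)

  IsMutualVisibilitySet : List V → Set
  IsMutualVisibilitySet S = ∀ u v → u ∈ S → v ∈ S → Visible S u v

  IsOuterMutualVisibilitySet : List V → Set
  IsOuterMutualVisibilitySet S =
    IsMutualVisibilitySet S × (∀ u v → u ∈ S → v ∉ S → Visible S u v)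

  OuterMVSetOfSize : ℕ → List V → Set
  OuterMVSetOfSize k S = Unique S × IsOuterMutualVisibilitySet S × length S ≡ k

  μo≡ : ℕ → Set
  μo≡ k = Σ (List V) (OuterMVSetOfSize k)
        × (∀ T → Unique T → IsOuterMutualVisibilitySet T → length T ≤ k)

  SameSet : List V → List V → Set
  SameSet S T = ∀ x → (x ∈ S) ⇔ (x ∈ T)

  UniqueμoSet : ℕ → Set
  UniqueμoSet k = Σ (List V) λ S → OuterMVSetOfSize k S
                × (∀ T → OuterMVSetOfSize k T → SameSet S T)

-- A vertex of the perfect binary tree of depth r is a binary word of
-- length ≤ r (root = [], children of w are false ∷ w and true ∷ w).
-- In GT(r) the leaves (words of length r) are shared by both copies,
-- and each copy c : Bool has its own non-leaf vertices (length < r).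

data GTV (r : ℕ) : Set where
  leaf : Vec Bool r → GTV r
  node : (c : Bool) (w : List Bool) → length w < r → GTV r

data Child (r : ℕ) : GTV r → GTV r → Set where
  node-node : ∀ c w b (p : length w < r) (q : length (b ∷ w) < r) →
              Child r (node c w p) (node c (b ∷ w) q)
  node-leaf : ∀ c w b (p : length w < r) (v : Vec Bool r) →
              toList v ≡ b ∷ w → Child r (node c w p) (leaf v)

GTAdj : (r : ℕ) → GTV r → GTV r → Set
GTAdj r u v = Child r u v ⊎ Child r v u

{-# OPTIONS --safe #-}
module Submission where

-- The 2^r leaves form an outer mutual-visibility set: a shortest path from a leaf to any vertex
-- can be taken inside one copy of the tree, and then it meets no other leaf. Conversely, let S be
-- an outer mutual-visibility set and x = (c, w) a node of S. If the children of x are nodes, then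
-- x is the only element of S among the leaves and the nodes of copy c; if they are leaves, then
-- neither they nor the twin (not c, w) of x lie in S. Each time there is a u ∈ S and a vertex z
-- all of whose shortest paths pass through x, as certified by a potential that is 1-Lipschitz on
-- GT(r) − x. Hence the code sending a leaf to its word and (c, w) to c followed by w padded to
-- length r − 1 is injective on S, so |S| ≤ 2^r; and if |S| = 2^r every word is a code, which
-- leaves no room for nodes in S.

open import Defs
open import Data.Bool using (Bool; true; false; not)
import Data.Bool as Bool
open import Data.Bool.Properties using (¬-not; not-¬)
open import Data.Empty using (⊥; ⊥-elim)
open import Data.List using (List; []; _∷_; _++_; _∷ʳ_; length; map; filter; reverse; replicate)
import Data.List.Properties as List
open import Data.List.Properties
  using ( length-++; length-map; length-replicate; length-reverse; ++-identityʳ; filter-notAll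
        ; unfold-reverse; reverse-involutive; reverse-++)
open import Data.List.Membership.Propositional using (_∈_; _∉_)
open import Data.List.Membership.Propositional.Properties
  using (∈-filter⁺; ∈-map⁺; ∈-map⁻; ∈-++⁺ˡ; ∈-++⁺ʳ)
import Data.List.Membership.DecPropositional as DecMembership
open import Data.List.Relation.Binary.Disjoint.Propositional using (Disjoint)
open import Data.List.Relation.Binary.Pointwise
  using (Pointwise-≡⇒≡; Pointwise-length; ≡⇒Pointwise-≡)
open import Data.List.Relation.Binary.Subset.Propositional using (_⊆_)
open import Data.List.Relation.Binary.Suffix.Heterogeneous using (Suffix; here; there)
open import Data.List.Relation.Binary.Suffix.Heterogeneous.Properties
  using (suffix?; length-mono; S[as][bs]⇒∣as∣≢1+∣bs∣)
open import Data.List.Relation.Unary.All as All using (All; []; _∷_)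
open import Data.List.Relation.Unary.All.Properties using (map⁺)
open import Data.List.Relation.Unary.AllPairs using ([]; _∷_)
open import Data.List.Relation.Unary.Any as Any using (here; there)
open import Data.List.Relation.Unary.Unique.Propositional using (Unique)
open import Data.List.Relation.Unary.Unique.Propositional.Properties
  using (++⁺) renaming (map⁺ to unique-map⁺)
open import Data.Nat using (ℕ; zero; suc; _+_; _∸_; _^_; _≤_; _<_; _<?_; z≤n; s≤s)
open import Data.Nat.Properties
  using ( ≤-refl; ≤-reflexive; ≤-trans; ≤-<-trans; <⇒≤; <⇒≱; ≮⇒≥; <-irrefl; <-irrelevant
        ; n≤1+n; m≤n⇒m≤1+n; m≤n+m; m≤n⇒m<n∨m≡n; m<n⇒0<n∸m
        ; +-comm; +-assoc; +-suc; +-identityʳ; +-monoˡ-≤; +-monoʳ-≤; +-monoˡ-<; +-monoʳ-<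
        ; +-∸-assoc; m+n∸n≡m; m+[n∸m]≡n; n∸n≡0; module ≤-Reasoning)
open import Data.Product using (Σ; _×_; _,_; proj₁; proj₂)
import Data.Sum as Sum
open import Data.Sum using (inj₁; inj₂)
open import Data.Unit using (⊤; tt)
open import Data.Vec using (Vec)
import Data.Vec as Vec
import Data.Vec.Properties as Vec
open import Function using (_∘_)
open import Function.Bundles using (mk⇔)
open import Relation.Binary.Definitions using (DecidableEquality; Symmetric)
open import Relation.Binary.PropositionalEquality
  using (_≡_; _≢_; refl; sym; trans; cong; cong₂; subst; module ≡-Reasoning)
open import Relation.Nullary using (¬_; Dec; yes; no; ¬?)

module _ {A : Set} (_≟_ : DecidableEquality A) where

  open DecMembership _≟_ using (_∈?_)

  private
    without : A → List A → List A
    without x = filter (λ y → ¬? (y ≟ x))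

    length-without : ∀ {x ys} → x ∈ ys → length (without x ys) < length ys
    length-without {x} {ys} x∈ys =
      filter-notAll (λ y → ¬? (y ≟ x)) ys (Any.map (λ { refl y≢x → y≢x refl }) x∈ys)

    ⊆-without : ∀ {x xs ys} → xs ⊆ ys → x ∉ xs → xs ⊆ without x ys
    ⊆-without xs⊆ys x∉xs y∈xs =
      ∈-filter⁺ (λ z → ¬? (z ≟ _)) (xs⊆ys y∈xs) λ { refl → x∉xs y∈xs }

  unique-⊆⇒length-≤ : ∀ {xs ys} → Unique xs → xs ⊆ ys → length xs ≤ length ys
  unique-⊆⇒length-≤ {[]} _ _ = z≤n
  unique-⊆⇒length-≤ {x ∷ xs} (x≢xs ∷ uxs) x∷xs⊆ys =
    ≤-<-trans (unique-⊆⇒length-≤ uxs (⊆-without (x∷xs⊆ys ∘ there) x∉xs))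
              (length-without (x∷xs⊆ys (here refl)))
    where
      x∉xs : x ∉ xs
      x∉xs x∈xs = All.lookup x≢xs x∈xs refl

  unique-⊆-length-≥⇒⊇ : ∀ {xs ys} → Unique xs → xs ⊆ ys →
                        length ys ≤ length xs → ys ⊆ xs
  unique-⊆-length-≥⇒⊇ {xs} uxs xs⊆ys ys≤xs {y} y∈ys with y ∈? xs
  ... | yes y∈xs = y∈xs
  ... | no y∉xs = ⊥-elim (<⇒≱ (≤-<-trans (unique-⊆⇒length-≤ uxs (⊆-without xs⊆ys y∉xs))
                                         (length-without y∈ys)) ys≤xs)

map-unique : ∀ {A B : Set} (f : A → B) {xs} →
             (∀ {a b} → a ∈ xs → b ∈ xs → f a ≡ f b → a ≡ b) → Unique xs → Unique (map f xs)
map-unique f {[]} _ _ = []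
map-unique f {x ∷ xs} inj (x≢xs ∷ uxs) =
  map⁺ (All.tabulate λ y∈xs fx≡fy → All.lookup x≢xs y∈xs (inj (here refl) (there y∈xs) fx≡fy))
  ∷ map-unique f (λ a∈ b∈ → inj (there a∈) (there b∈)) uxs

Near : ℕ → ℕ → Set
Near m n = m ≤ suc n × n ≤ suc m

near-sym : ∀ {m n} → Near m n → Near n m
near-sym (m≤1+n , n≤1+m) = n≤1+m , m≤1+n

near-suc : ∀ n → Near n (suc n)
near-suc n = m≤n⇒m≤1+n (n≤1+n n) , ≤-refl

near-+ˡ : ∀ k {m n} → Near m n → Near (k + m) (k + n)
near-+ˡ k (m≤1+n , n≤1+m) = ≤-trans (+-monoʳ-≤ k m≤1+n) (≤-reflexive (+-suc k _))
                          , ≤-trans (+-monoʳ-≤ k n≤1+m) (≤-reflexive (+-suc k _))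

near-+ʳ : ∀ k {m n} → Near m n → Near (m + k) (n + k)
near-+ʳ k (m≤1+n , n≤1+m) = +-monoˡ-≤ k m≤1+n , +-monoˡ-≤ k n≤1+m

module WalkLemmas {V : Set} {Adj : V → V → Set} where
  open GraphNotions Adj

  infixr 5 _++ʷ_

  _++ʷ_ : ∀ {a b c} → Walk a b → Walk b c → Walk a c
  [] ++ʷ q = q
  (e ∷ p) ++ʷ q = e ∷ (p ++ʷ q)

  len-++ʷ : ∀ {a b c} (p : Walk a b) (q : Walk b c) → len (p ++ʷ q) ≡ len p + len q
  len-++ʷ [] q = refl
  len-++ʷ (e ∷ p) q = cong suc (len-++ʷ p q)

  module _ {P : V → Set} where

    interior-∷ : ∀ {a b c} (e : Adj a b) (q : Walk b c) →
                 P b → All P (interior q) → All P (interior (e ∷ q))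
    interior-∷ e [] _ _ = []
    interior-∷ e (_ ∷ _) Pb Pq = Pb ∷ Pq

    interior-++ʷ : ∀ {a b c} (p : Walk a b) (q : Walk b c) →
                   All P (interior p) → P b → All P (interior q) → All P (interior (p ++ʷ q))
    interior-++ʷ [] q _ _ Pq = Pq
    interior-++ʷ (e ∷ []) q _ Pb Pq = interior-∷ e q Pb Pq
    interior-++ʷ (e ∷ p@(_ ∷ _)) q (Pw ∷ Pp) Pb Pq = Pw ∷ interior-++ʷ p q Pp Pb Pq

  module _ (sym-adj : Symmetric Adj) where

    reverseʷ : ∀ {a b} → Walk a b → Walk b a
    reverseʷ [] = []
    reverseʷ (e ∷ p) = reverseʷ p ++ʷ (sym-adj e ∷ [])

    len-reverseʷ : ∀ {a b} (p : Walk a b) → len (reverseʷ p) ≡ len p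
    len-reverseʷ [] = refl
    len-reverseʷ (e ∷ p) =
      trans (len-++ʷ (reverseʷ p) _) (trans (cong (_+ 1) (len-reverseʷ p)) (+-comm (len p) 1))

    interior-reverseʷ : ∀ {P : V → Set} {a b} (p : Walk a b) →
                        All P (interior p) → All P (interior (reverseʷ p))
    interior-reverseʷ [] _ = []
    interior-reverseʷ (e ∷ []) _ = []
    interior-reverseʷ (e ∷ p@(_ ∷ _)) (Pw ∷ Pp) =
      interior-++ʷ (reverseʷ p) _ (interior-reverseʷ p Pp) Pw []

  LipschitzOn : (V → Set) → (V → ℕ) → Set
  LipschitzOn P f = ∀ {a b} → Adj a b → P a → P b → f a ≤ suc (f b)

  lipschitz-walk : ∀ {P f} → LipschitzOn P f → ∀ {a b} (p : Walk a b) →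
                   P a → P b → All P (interior p) → f a ≤ len p + f b
  lipschitz-walk lip [] _ _ _ = ≤-refl
  lipschitz-walk lip (e ∷ []) Pa Pb _ = lip e Pa Pb
  lipschitz-walk lip (e ∷ p@(_ ∷ _)) Pa Pb (Pw ∷ Pp) =
    ≤-trans (lip e Pa Pw) (s≤s (lipschitz-walk lip p Pw Pb Pp))

  module _ (_≟_ : DecidableEquality V) {S : List V} (outer : IsOuterMutualVisibilitySet S) where

    open DecMembership _≟_ using (_∈?_)

    outer-visible : ∀ {u} z → u ∈ S → Visible S u z
    outer-visible z u∈S with z ∈? S
    ... | yes z∈S = proj₁ outer _ z u∈S z∈S
    ... | no z∉S = proj₂ outer _ z u∈S z∉S

    outer-lipschitz-bound : ∀ {x u z f} → x ∈ S → u ∈ S → LipschitzOn (_≢ x) f →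
                            u ≢ x → z ≢ x → (q : Walk u z) → f u ≤ len q + f z
    outer-lipschitz-bound {x} {_} {z} {f} x∈S u∈S lip u≢x z≢x q
      with p , p-shortest , p-avoids-S ← outer-visible z u∈S =
      ≤-trans (lipschitz-walk lip p u≢x z≢x (All.map avoids-x p-avoids-S))
              (+-monoˡ-≤ (f z) (p-shortest q))
      where
        avoids-x : ∀ {y} → y ∉ S → y ≢ x
        avoids-x y∉S refl = y∉S x∈S

-- δ is the tree distance between root-first words; the vertices of GT(r) carry leaf-first words
-- (pos below), hence the reversals in dist.
module TreeDistance {A : Set} (_≟_ : DecidableEquality A) where

  private
    δ : List A → List A → ℕ
    δ [] q = length q
    δ p@(_ ∷ _) [] = length p
    δ (a ∷ p) (b ∷ q) with a ≟ b
    ... | yes _ = δ p q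
    ... | no _ = suc (length p) + suc (length q)

    δ-refl : ∀ p → δ p p ≡ 0
    δ-refl [] = refl
    δ-refl (a ∷ p) with a ≟ a
    ... | yes _ = δ-refl p
    ... | no a≢a = ⊥-elim (a≢a refl)

    near-δ-∷ʳ : ∀ p q b → Near (δ p q) (δ (p ∷ʳ b) q)
    near-δ-∷ʳ [] [] b = near-suc 0
    near-δ-∷ʳ [] (a ∷ q) b with b ≟ a
    ... | yes _ = near-sym (near-suc (length q))
    ... | no _ = near-suc (suc (length q))
    near-δ-∷ʳ (a ∷ p) [] b rewrite length-++ p {b ∷ []} | +-comm (length p) 1 =
      near-suc (suc (length p))
    near-δ-∷ʳ (a ∷ p) (a′ ∷ q) b with a ≟ a′
    ... | yes _ = near-δ-∷ʳ p q b
    ... | no _ rewrite length-++ p {b ∷ []} | +-comm (length p) 1 =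
      near-suc (suc (length p) + suc (length q))

    δ-split : ∀ p q → Σ (List A) λ c → Σ (List A) λ p′ → Σ (List A) λ q′ →
              p ≡ c ++ p′ × q ≡ c ++ q′ × δ p q ≡ length p′ + length q′
    δ-split [] q = [] , [] , q , refl , refl , refl
    δ-split p@(_ ∷ _) [] = [] , p , [] , refl , refl , sym (+-identityʳ _)
    δ-split (a ∷ p) (b ∷ q) with a ≟ b
    ... | no _ = [] , a ∷ p , b ∷ q , refl , refl , refl
    ... | yes refl with c , p′ , q′ , refl , refl , eq ← δ-split p q =
      a ∷ c , p′ , q′ , refl , refl , eq

  dist : List A → List A → ℕ
  dist w₁ w₂ = δ (reverse w₁) (reverse w₂)

  dist-refl : ∀ w → dist w w ≡ 0
  dist-refl w = δ-refl (reverse w)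

  near-dist-∷ : ∀ b w x → Near (dist w x) (dist (b ∷ w) x)
  near-dist-∷ b w x rewrite unfold-reverse b w = near-δ-∷ʳ (reverse w) (reverse x) b

  dist-split : ∀ w₁ w₂ → Σ (List A) λ m → Σ (List A) λ xs → Σ (List A) λ ys →
               w₁ ≡ xs ++ m × w₂ ≡ ys ++ m × dist w₁ w₂ ≡ length xs + length ys
  dist-split w₁ w₂ with c , p₁ , p₂ , e₁ , e₂ , eq ← δ-split (reverse w₁) (reverse w₂) =
    reverse c , reverse p₁ , reverse p₂ , unreverse w₁ e₁ , unreverse w₂ e₂ ,
    trans eq (sym (cong₂ _+_ (length-reverse p₁) (length-reverse p₂)))
    where
      unreverse : ∀ w {p} → reverse w ≡ c ++ p → w ≡ reverse p ++ reverse c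
      unreverse w {p} e = trans (sym (reverse-involutive w)) (trans (cong reverse e) (reverse-++ c p))

module _ {A : Set} where

  suffix-∷⁻ : ∀ {m b} {l : List A} → Suffix _≡_ m (b ∷ l) → ¬ Suffix _≡_ m l → m ≡ b ∷ l
  suffix-∷⁻ (here m≋b∷l) _ = Pointwise-≡⇒≡ m≋b∷l
  suffix-∷⁻ (there m⊑l) m⋢l = ⊥-elim (m⋢l m⊑l)

  suffix-unique : ∀ {m₁ m₂ l : List A} → Suffix _≡_ m₁ l → Suffix _≡_ m₂ l →
                  length m₁ ≡ length m₂ → m₁ ≡ m₂
  suffix-unique (here m₁≋l) (here m₂≋l) _ =
    trans (Pointwise-≡⇒≡ m₁≋l) (sym (Pointwise-≡⇒≡ m₂≋l))
  suffix-unique (here m₁≋l) (there m₂⊑l) eq =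
    ⊥-elim (S[as][bs]⇒∣as∣≢1+∣bs∣ m₂⊑l (trans (sym eq) (Pointwise-length m₁≋l)))
  suffix-unique (there m₁⊑l) (here m₂≋l) eq =
    ⊥-elim (S[as][bs]⇒∣as∣≢1+∣bs∣ m₁⊑l (trans eq (Pointwise-length m₂≋l)))
  suffix-unique (there m₁⊑l) (there m₂⊑l) eq = suffix-unique m₁⊑l m₂⊑l eq

  vector-of : ∀ {n} (l : List A) → length l ≡ n → Σ (Vec A n) λ v → Vec.toList v ≡ l
  vector-of l refl = Vec.fromList l , Vec.toList∘fromList l

vectors : ∀ n → List (Vec Bool n)
vectors zero = Vec.[] ∷ []
vectors (suc n) = map (false Vec.∷_) (vectors n) ++ map (true Vec.∷_) (vectors n)

length-vectors : ∀ n → length (vectors n) ≡ 2 ^ n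
length-vectors zero = refl
length-vectors (suc n) = begin
  length (map (false Vec.∷_) (vectors n) ++ map (true Vec.∷_) (vectors n))
    ≡⟨ length-++ (map (false Vec.∷_) (vectors n)) ⟩
  length (map (false Vec.∷_) (vectors n)) + length (map (true Vec.∷_) (vectors n))
    ≡⟨ cong₂ _+_ (length-map _ (vectors n)) (length-map _ (vectors n)) ⟩
  length (vectors n) + length (vectors n)
    ≡⟨ cong (λ k → k + k) (length-vectors n) ⟩
  2 ^ n + 2 ^ n
    ≡⟨ cong (2 ^ n +_) (sym (+-identityʳ (2 ^ n))) ⟩
  2 ^ suc n ∎
  where open ≡-Reasoning

∈-vectors : ∀ {n} (v : Vec Bool n) → v ∈ vectors n
∈-vectors Vec.[] = here refl
∈-vectors (false Vec.∷ v) = ∈-++⁺ˡ (∈-map⁺ (false Vec.∷_) (∈-vectors v))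
∈-vectors {suc n} (true Vec.∷ v) =
  ∈-++⁺ʳ (map (false Vec.∷_) (vectors n)) (∈-map⁺ (true Vec.∷_) (∈-vectors v))

vectors-unique : ∀ n → Unique (vectors n)
vectors-unique zero = [] ∷ []
vectors-unique (suc n) = ++⁺ (with-head false) (with-head true) heads-differ
  where
    with-head : ∀ b → Unique (map (b Vec.∷_) (vectors n))
    with-head b = unique-map⁺ Vec.∷-injectiveʳ (vectors-unique n)

    heads-differ : Disjoint (map (false Vec.∷_) (vectors n)) (map (true Vec.∷_) (vectors n))
    heads-differ (v∈falses , v∈trues) with _ , _ , refl ← ∈-map⁻ (false Vec.∷_) v∈falses
                                     with _ , _ , () ← ∈-map⁻ (true Vec.∷_) v∈trues

module GluedTree (r : ℕ) where
  open GraphNotions (GTAdj r)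
  open WalkLemmas {GTV r} {GTAdj r}
  open TreeDistance Bool._≟_

  pos : GTV r → List Bool
  pos (leaf v) = Vec.toList v
  pos (node _ w _) = w

  node-≡ : ∀ {c w} (p q : length w < r) → node c w p ≡ node c w q
  node-≡ {c} {w} p q = cong (node c w) (<-irrelevant p q)

  node-copy : ∀ {c c′ w w′ p p′} → node {r} c w p ≡ node c′ w′ p′ → c ≡ c′
  node-copy refl = refl

  node-word : ∀ {c c′ w w′ p p′} → node {r} c w p ≡ node c′ w′ p′ → w ≡ w′
  node-word refl = refl

  parent≢child : ∀ {c c′ b w p q} → node {r} c w p ≢ node c′ (b ∷ w) q
  parent≢child eq = <-irrefl (cong length (node-word eq)) ≤-refl

  _≟ᵥ_ : DecidableEquality (GTV r)
  leaf v ≟ᵥ leaf v′ with Vec.≡-dec Bool._≟_ v v′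
  ... | yes refl = yes refl
  ... | no v≢v′ = no λ { refl → v≢v′ refl }
  leaf _ ≟ᵥ node _ _ _ = no λ ()
  node _ _ _ ≟ᵥ leaf _ = no λ ()
  node c w p ≟ᵥ node c′ w′ p′ with c Bool.≟ c′ | List.≡-dec Bool._≟_ w w′
  ... | yes refl | yes refl = yes (node-≡ p p′)
  ... | no c≢c′ | _ = no λ { refl → c≢c′ refl }
  ... | _ | no w≢w′ = no λ { refl → w≢w′ refl }

  adj-sym : Symmetric (GTAdj r)
  adj-sym = Sum.swap

  data InCopy (c : Bool) : GTV r → Set where
    inLeaf : ∀ {v} → InCopy c (leaf v)
    inNode : ∀ {w p} → InCopy c (node c w p)

  some-copy : ∀ z → Σ Bool λ c → InCopy c z
  some-copy (leaf _) = false , inLeaf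
  some-copy (node c _ _) = c , inNode

  data IsNode : GTV r → Set where
    isNode : ∀ {c w p} → IsNode (node c w p)

  length-leaf : ∀ v → length (pos (leaf v)) ≡ r
  length-leaf = Vec.length-toList

  length-pos : ∀ z → length (pos z) ≤ r
  length-pos (leaf v) = ≤-reflexive (length-leaf v)
  length-pos (node _ _ p) = <⇒≤ p

  leaf-depth : ∀ {v b w} → pos (leaf v) ≡ b ∷ w → suc (length w) ≡ r
  leaf-depth {v} e = trans (sym (cong length e)) (length-leaf v)

  leaf-pos-injective : ∀ {a b} → pos a ≡ pos b → r ≤ length (pos a) → a ≡ b
  leaf-pos-injective {leaf v} {leaf v′} e _ =
    cong leaf (trans (sym (Vec.cast-is-id refl v)) (Vec.toList-injective refl v v′ e))
  leaf-pos-injective {leaf v} {node _ _ p} refl _ = ⊥-elim (<-irrefl (length-leaf v) p)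
  leaf-pos-injective {node _ _ p} _ r≤w = ⊥-elim (<⇒≱ p r≤w)

  child-pos : ∀ {a b} → Child r a b → Σ Bool λ β → pos b ≡ β ∷ pos a
  child-pos (node-node _ _ β _ _) = β , refl
  child-pos (node-leaf _ _ β _ _ e) = β , e

  parent-edge : ∀ {c z b w} → InCopy c z → pos z ≡ b ∷ w →
                Σ (length w < r) λ p → Child r (node c w p) z
  parent-edge {c} {b = b} {w} (inLeaf {v}) e =
    ≤-reflexive (leaf-depth e) , node-leaf c w b (≤-reflexive (leaf-depth e)) v e
  parent-edge {c} {b = b} {w} (inNode {p = q}) refl = <⇒≤ q , node-node c w b (<⇒≤ q) q

  node-at : ∀ {c z m} → InCopy c z → pos z ≡ m → (p : length m < r) → z ≡ node c m p
  node-at (inLeaf {v}) refl p = ⊥-elim (<-irrefl (length-leaf v) p)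
  node-at (inNode {p = q}) refl p = node-≡ q p

  ascend : ∀ {c z} → InCopy c z → ∀ xs {m} → pos z ≡ xs ++ m → (p : length m < r) →
           Σ (Walk z (node c m p)) λ q → len q ≡ length xs × All IsNode (interior q)
  ascend z∈c [] e p with refl ← node-at z∈c e p = [] , refl , []
  ascend z∈c (_ ∷ xs) e p
    with _ , edge ← parent-edge z∈c e
    with q , len-q , q-nodes ← ascend inNode xs refl p =
    inj₂ edge ∷ q , cong suc len-q , interior-∷ (inj₂ edge) q isNode q-nodes

  no-prefix-above-leaves : ∀ z xs {m} → pos z ≡ xs ++ m → r ≤ length m → xs ≡ []
  no-prefix-above-leaves _ [] _ _ = refl
  no-prefix-above-leaves z (x ∷ xs) {m} e r≤m = ⊥-elim (<-irrefl refl (begin-strict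
    r                           ≤⟨ r≤m ⟩
    length m                    ≤⟨ m≤n+m (length m) (length xs) ⟩
    length xs + length m        <⟨ ≤-refl ⟩
    suc (length xs + length m)  ≡⟨ cong suc (length-++ xs) ⟨
    length (x ∷ xs ++ m)        ≡⟨ cong length e ⟨
    length (pos z)              ≤⟨ length-pos z ⟩
    r                           ∎))
    where open ≤-Reasoning

  copy-walk : ∀ {c a b} → InCopy c a → InCopy c b →
              Σ (Walk a b) λ q → len q ≡ dist (pos a) (pos b) × All IsNode (interior q)
  copy-walk {a = a} {b} a∈c b∈c
    with m , xs , ys , ea , eb , d ← dist-split (pos a) (pos b)
    with length m <? r
  ... | yes p
    with up , len-up , up-nodes ← ascend a∈c xs ea p
    with down , len-down , down-nodes ← ascend b∈c ys eb p =
    up ++ʷ reverseʷ adj-sym down ,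
    trans (len-++ʷ up _) (trans (cong₂ _+_ len-up (trans (len-reverseʷ adj-sym down) len-down)) (sym d)) ,
    interior-++ʷ up _ up-nodes isNode (interior-reverseʷ adj-sym down down-nodes)
  ... | no m≮r
    with refl ← no-prefix-above-leaves a xs ea (≮⇒≥ m≮r)
    with refl ← no-prefix-above-leaves b ys eb (≮⇒≥ m≮r)
    with refl ← leaf-pos-injective {a} {b} (trans ea (sym eb))
                  (subst (λ l → r ≤ length l) (sym ea) (≮⇒≥ m≮r)) =
    [] , sym d , []

  Lipschitz : (GTV r → ℕ) → Set
  Lipschitz f = ∀ {a b} → Child r a b → Near (f a) (f b)

  lipschitzOn-children : ∀ {P f} → (∀ {a b} → Child r a b → P a → P b → Near (f a) (f b)) →
                         LipschitzOn P f
  lipschitzOn-children near (inj₁ e) Pa Pb = proj₁ (near e Pa Pb)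
  lipschitzOn-children near (inj₂ e) Pa Pb = proj₂ (near e Pb Pa)

  dist-lipschitz : ∀ x → Lipschitz (λ z → dist (pos z) x)
  dist-lipschitz x {a} e with β , eb ← child-pos e rewrite eb = near-dist-∷ β (pos a) x

  dist-≤-len : ∀ {a b} (q : Walk a b) → dist (pos a) (pos b) ≤ len q
  dist-≤-len {a} {b} q = subst (dist (pos a) (pos b) ≤_) len-q+0 (lipschitz-walk lip q tt tt all-⊤)
    where
      lip : LipschitzOn (λ _ → ⊤) (λ z → dist (pos z) (pos b))
      lip = lipschitzOn-children λ e _ _ → dist-lipschitz (pos b) e

      all-⊤ : All (λ _ → ⊤) (interior q)
      all-⊤ = All.universal (λ _ → tt) _

      len-q+0 : len q + dist (pos b) (pos b) ≡ len q
      len-q+0 = trans (cong (len q +_) (dist-refl (pos b))) (+-identityʳ (len q))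

  leaves : List (GTV r)
  leaves = map leaf (vectors r)

  leaves-unique : Unique leaves
  leaves-unique = unique-map⁺ (λ { refl → refl }) (vectors-unique r)

  length-leaves : length leaves ≡ 2 ^ r
  length-leaves = trans (length-map leaf (vectors r)) (length-vectors r)

  leaf∈leaves : ∀ v → leaf v ∈ leaves
  leaf∈leaves v = ∈-map⁺ leaf (∈-vectors v)

  node∉leaves : ∀ {z} → IsNode z → z ∉ leaves
  node∉leaves isNode z∈leaves with _ , _ , () ← ∈-map⁻ leaf z∈leaves

  leaf-visible : ∀ v z → Visible leaves (leaf v) z
  leaf-visible v z with c , z∈c ← some-copy z with q , len-q , q-nodes ← copy-walk {c} inLeaf z∈c =
    q , (λ q′ → subst (_≤ len q′) (sym len-q) (dist-≤-len q′)) , All.map node∉leaves q-nodes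

  leaves-outer : IsOuterMutualVisibilitySet leaves
  leaves-outer = (λ u z u∈ _ → visible u z u∈) , (λ u z u∈ _ → visible u z u∈)
    where
      visible : ∀ u z → u ∈ leaves → Visible leaves u z
      visible u z u∈leaves with v , _ , refl ← ∈-map⁻ leaf u∈leaves = leaf-visible v z

  opposite : ℕ → ℕ
  opposite d = (r ∸ d) + r

  r<opposite : ∀ {d} → d < r → r < opposite d
  r<opposite d<r = +-monoˡ-< r (m<n⇒0<n∸m d<r)

  -- The position of z on the axis running from the root of copy c (0) through the leaves (r)
  -- to the root of the other copy (2r); it moves by one along every edge.
  coord : Bool → GTV r → ℕ
  coord c (leaf _) = r
  coord c (node c′ w _) with c′ Bool.≟ c
  ... | yes _ = length w
  ... | no _ = opposite (length w)

  coord-here : ∀ {c} w (p : length w < r) → coord c (node c w p) ≡ length w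
  coord-here {c} _ p with c Bool.≟ c
  ... | yes _ = refl
  ... | no c≢c = ⊥-elim (c≢c refl)

  coord-there : ∀ {c c′} w (p : length w < r) → c′ ≢ c →
                coord c (node c′ w p) ≡ opposite (length w)
  coord-there {c} {c′} _ p c′≢c with c′ Bool.≟ c
  ... | yes c′≡c = ⊥-elim (c′≢c c′≡c)
  ... | no _ = refl

  coord-lipschitz : ∀ c → Lipschitz (coord c)
  coord-lipschitz c (node-node c′ w _ p _) with c′ Bool.≟ c
  ... | yes _ = near-suc (length w)
  ... | no _ rewrite +-∸-assoc 1 p = near-sym (near-suc _)
  coord-lipschitz c (node-leaf c′ w _ _ v e) with c′ Bool.≟ c
  ... | yes _ = subst (Near (length w)) (leaf-depth e) (near-suc (length w))
  ... | no _ = subst (λ k → Near (k + r) r) (sym one-level-above) (near-sym (near-suc r))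
    where
      one-level-above : r ∸ length w ≡ 1
      one-level-above = trans (cong (_∸ length w) (sym (leaf-depth e))) (m+n∸n≡m 1 (length w))

  -- In both copies at once: pos forgets the copy.
  InSubtree : List Bool → GTV r → Set
  InSubtree m z = Suffix _≡_ m (pos z)

  inSubtree? : ∀ m z → Dec (InSubtree m z)
  inSubtree? m z = suffix? Bool._≟_ m (pos z)

  false≢true : false ≢ true
  false≢true ()

  outside-some-child-subtree : ∀ w z → Σ Bool λ β → ¬ InSubtree (β ∷ w) z
  outside-some-child-subtree w z with inSubtree? (false ∷ w) z
  ... | no z∉ = false , z∉
  ... | yes z∈ = true , λ z∈′ → false≢true (List.∷-injectiveˡ (suffix-unique z∈ z∈′ refl))

  piecewise : List Bool → (GTV r → ℕ) → (GTV r → ℕ) → GTV r → ℕ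
  piecewise m inside outside z with inSubtree? m z
  ... | yes _ = inside z
  ... | no _ = outside z

  module _ {m : List Bool} {inside outside : GTV r → ℕ} where

    piecewise-in : ∀ {z} → InSubtree m z → piecewise m inside outside z ≡ inside z
    piecewise-in {z} z∈ with inSubtree? m z
    ... | yes _ = refl
    ... | no z∉ = ⊥-elim (z∉ z∈)

    piecewise-out : ∀ {z} → ¬ InSubtree m z → piecewise m inside outside z ≡ outside z
    piecewise-out {z} z∉ with inSubtree? m z
    ... | yes z∈ = ⊥-elim (z∉ z∈)
    ... | no _ = refl

    piecewise-lipschitz : ∀ x → Lipschitz inside → Lipschitz outside →
      (∀ {a b} → Child r a b → pos b ≡ m → a ≢ x → b ≢ x → inside a ≡ outside a) →
      LipschitzOn (_≢ x) (piecewise m inside outside)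
    piecewise-lipschitz x inside-lip outside-lip agree = lipschitzOn-children near
      where
        near : ∀ {a b} → Child r a b → a ≢ x → b ≢ x →
               Near (piecewise m inside outside a) (piecewise m inside outside b)
        near {a} {b} e a≢x b≢x with β , eb ← child-pos e with inSubtree? m a | inSubtree? m b
        ... | yes _ | yes _ = inside-lip e
        ... | no _ | no _ = outside-lip e
        ... | yes a∈ | no b∉ = ⊥-elim (b∉ (subst (Suffix _≡_ m) (sym eb) (there a∈)))
        ... | no a∉ | yes b∈ =
          subst (λ k → Near k (inside b)) (agree e b-on-boundary a≢x b≢x) (inside-lip e)
          where
            b-on-boundary : pos b ≡ m
            b-on-boundary = trans eb (sym (suffix-∷⁻ (subst (Suffix _≡_ m) eb b∈) a∉))

  -- In GT(r) − node c w, the subtree of the child at β ∷ w is entered from outside only through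
  -- the node of the other copy at w, where both pieces equal opposite (length w).
  childPotential : Bool → List Bool → Bool → GTV r → ℕ
  childPotential c w β = piecewise (β ∷ w) (coord c) (λ z → dist (pos z) w + opposite (length w))

  module _ {c : Bool} {w : List Bool} {β : Bool} where

    childPotential-lipschitz : (p : length w < r) → LipschitzOn (_≢ node c w p) (childPotential c w β)
    childPotential-lipschitz p = piecewise-lipschitz (node c w p) (coord-lipschitz c)
      (λ e → near-+ʳ (opposite (length w)) (dist-lipschitz w e)) agree
      where
        other-copy : ∀ {c′} (p′ : length w < r) → node c′ w p′ ≢ node c w p →
                     coord c (node c′ w p′) ≡ dist w w + opposite (length w)
        other-copy {c′} p′ a≢x =
          trans (coord-there {c} {c′} w p′ (λ { refl → a≢x (node-≡ p′ p) }))
                (cong (_+ opposite (length w)) (sym (dist-refl w)))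

        agree : ∀ {a b} → Child r a b → pos b ≡ β ∷ w → a ≢ node c w p → b ≢ node c w p →
                coord c a ≡ dist (pos a) w + opposite (length w)
        agree (node-node _ _ _ p′ _) refl a≢x _ = other-copy p′ a≢x
        agree (node-leaf _ _ _ p′ _ e) eb a≢x _
          with refl ← List.∷-injectiveʳ (trans (sym e) eb) = other-copy p′ a≢x

    childPotential-outside : ∀ {z} → ¬ InSubtree (β ∷ w) z →
                             childPotential c w β z ≡ dist (pos z) w + opposite (length w)
    childPotential-outside = piecewise-out {β ∷ w} {coord c}

    childPotential-child : (q : suc (length w) < r) →
                           childPotential c w β (node c (β ∷ w) q) ≡ suc (length w)
    childPotential-child q =
      trans (piecewise-in {β ∷ w} {coord c} {z = node c (β ∷ w) q} (here (≡⇒Pointwise-≡ refl)))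
            (coord-here {c} (β ∷ w) q)

  -- In GT(r) − node c (γ ∷ wm), the subtree of that node is entered from outside only through the
  -- node of the other copy at wm, where both pieces equal opposite (length wm) + length wm.
  parentPotential : Bool → Bool → List Bool → GTV r → ℕ
  parentPotential c γ wm =
    piecewise (γ ∷ wm) (λ z → opposite (length wm) + coord (not c) z) (λ z → coord c z + length wm)

  module _ {c γ : Bool} {wm : List Bool} where

    parentPotential-lipschitz : (p : length (γ ∷ wm) < r) →
                                LipschitzOn (_≢ node c (γ ∷ wm) p) (parentPotential c γ wm)
    parentPotential-lipschitz p = piecewise-lipschitz (node c (γ ∷ wm) p)
      (λ e → near-+ˡ (opposite (length wm)) (coord-lipschitz (not c) e))
      (λ e → near-+ʳ (length wm) (coord-lipschitz c e)) agree
      where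
        agree : ∀ {a b} → Child r a b → pos b ≡ γ ∷ wm →
                a ≢ node c (γ ∷ wm) p → b ≢ node c (γ ∷ wm) p →
                opposite (length wm) + coord (not c) a ≡ coord c a + length wm
        agree (node-node c′ _ _ p′ q′) refl _ b≢x
          with refl ← ¬-not {c′} {c} (λ { refl → b≢x (node-≡ q′ p) }) =
          trans (cong (opposite (length wm) +_) (coord-here {not c} wm p′))
                (cong (_+ length wm) (sym (coord-there {c} wm p′ (λ e → not-¬ refl (sym e)))))
        agree (node-leaf _ _ _ _ _ _) eb _ _ = ⊥-elim (<-irrefl (leaf-depth eb) p)

    parentPotential-inside : ∀ {z} → InSubtree (γ ∷ wm) z →
                             parentPotential c γ wm z ≡ opposite (length wm) + coord (not c) z
    parentPotential-inside =
      piecewise-in {γ ∷ wm} {λ z → opposite (length wm) + coord (not c) z} {λ z → coord c z + length wm}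

    parentPotential-parent : (q : length wm < r) →
                             parentPotential c γ wm (node c wm q) ≡ length wm + length wm
    parentPotential-parent q = trans
      (piecewise-out {γ ∷ wm} {λ z → opposite (length wm) + coord (not c) z} {λ z → coord c z + length wm}
                     (λ γwm⊑wm → <-irrefl refl (length-mono γwm⊑wm)))
      (cong (_+ length wm) (coord-here {c} wm q))

  module _ {S : List (GTV r)} (outer : IsOuterMutualVisibilitySet S) where

    deep-member-separates : ∀ {c w p u β} (q : suc (length w) < r) → node c w p ∈ S → u ∈ S →
                            u ≢ node c w p → InCopy c u → ¬ InSubtree (β ∷ w) u → ⊥
    deep-member-separates {c} {w} {p} {u} {β} q x∈S u∈S u≢x u∈c u∉ = <-irrefl refl (begin-strict
        D + opposite (length w)   ≡⟨ childPotential-outside {c} u∉ ⟨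
        h u                       ≤⟨ avoiding-x ⟩
        len walk + h v            ≡⟨ cong₂ _+_ len-walk (childPotential-child {c} {w} {β} q) ⟩
        D + 1 + suc (length w)    ≡⟨ +-assoc D 1 (suc (length w)) ⟩
        D + suc (suc (length w))  ≤⟨ +-monoʳ-≤ D q ⟩
        D + r                     <⟨ +-monoʳ-< D (r<opposite p) ⟩
        D + opposite (length w)   ∎)
      where
        open ≤-Reasoning

        D : ℕ
        D = dist (pos u) w

        h : GTV r → ℕ
        h = childPotential c w β

        h-lipschitz : LipschitzOn (_≢ node c w p) h
        h-lipschitz = childPotential-lipschitz p

        v : GTV r
        v = node c (β ∷ w) q

        v≢x : v ≢ node c w p
        v≢x = parent≢child ∘ sym

        to-x : Σ (Walk u (node c w p)) λ q → len q ≡ D × All IsNode (interior q)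
        to-x = copy-walk u∈c inNode

        walk : Walk u v
        walk = proj₁ to-x ++ʷ (inj₁ (node-node c w β p q) ∷ [])

        len-walk : len walk ≡ D + 1
        len-walk = trans (len-++ʷ (proj₁ to-x) _) (cong (_+ 1) (proj₁ (proj₂ to-x)))

        avoiding-x : h u ≤ len walk + h v
        avoiding-x = outer-lipschitz-bound _≟ᵥ_ outer x∈S u∈S h-lipschitz u≢x v≢x walk

    deep-member-alone : ∀ {c w p u} → suc (length w) < r → node c w p ∈ S → u ∈ S →
                        InCopy c u → u ≡ node c w p
    deep-member-alone {c} {w} {p} {u} q x∈S u∈S u∈c with u ≟ᵥ node c w p
    ... | yes u≡x = u≡x
    ... | no u≢x with _ , u∉ ← outside-some-child-subtree w u =
      ⊥-elim (deep-member-separates q x∈S u∈S u≢x u∈c u∉)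

    leaf-child-separates : ∀ {c γ wm p v β} → node c (γ ∷ wm) p ∈ S → leaf v ∈ S →
                           pos (leaf v) ≡ β ∷ γ ∷ wm → ⊥
    leaf-child-separates {c} {γ} {wm} {p} {v} {β} x∈S ℓ∈S e = <-irrefl refl (begin-strict
        2 + (n + n)      ≤⟨ +-monoˡ-≤ n p ⟩
        r + n            <⟨ +-monoʳ-< r (<⇒≤ p) ⟩
        r + r            ≤⟨ +-monoˡ-≤ r (m≤n+m r (r ∸ n)) ⟩
        opposite n + r   ≡⟨ parentPotential-inside {c} ℓ-below-x ⟨
        h (leaf v)       ≤⟨ avoiding-x ⟩
        2 + h parent     ≡⟨ cong (2 +_) (parentPotential-parent {c} {γ} {wm} (<⇒≤ p)) ⟩
        2 + (n + n)      ∎)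
      where
        open ≤-Reasoning

        n : ℕ
        n = length wm

        h : GTV r → ℕ
        h = parentPotential c γ wm

        h-lipschitz : LipschitzOn (_≢ node c (γ ∷ wm) p) h
        h-lipschitz = parentPotential-lipschitz p

        parent : GTV r
        parent = node c wm (<⇒≤ p)

        ℓ-below-x : InSubtree (γ ∷ wm) (leaf v)
        ℓ-below-x = subst (Suffix _≡_ (γ ∷ wm)) (sym e) (there (here (≡⇒Pointwise-≡ refl)))

        walk : Walk (leaf v) parent
        walk = inj₂ (node-leaf c (γ ∷ wm) β p v e) ∷ inj₂ (node-node c wm γ (<⇒≤ p) p) ∷ []

        avoiding-x : h (leaf v) ≤ len walk + h parent
        avoiding-x = outer-lipschitz-bound _≟ᵥ_ outer x∈S ℓ∈S h-lipschitz (λ ()) parent≢child walk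

    twin-separates : ∀ {c γ wm p p′} → suc (length (γ ∷ wm)) ≡ r →
                     node c (γ ∷ wm) p ∈ S → node (not c) (γ ∷ wm) p′ ∈ S → ⊥
    twin-separates {c} {γ} {wm} {p} {p′} above-leaves x∈S y∈S = <-irrefl refl (begin-strict
        3 + (n + n)          ≤⟨ +-monoˡ-≤ n (s≤s p) ⟩
        suc r + n            ≤⟨ +-monoˡ-≤ n (r<opposite (<⇒≤ p)) ⟩
        opposite n + n       <⟨ +-monoʳ-< (opposite n) ≤-refl ⟩
        opposite n + suc n   ≡⟨ h-y ⟨
        h y                  ≤⟨ avoiding-x ⟩
        3 + h parent         ≡⟨ cong (3 +_) (parentPotential-parent {c} {γ} {wm} (<⇒≤ p)) ⟩
        3 + (n + n)          ∎)
      where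
        open ≤-Reasoning

        n : ℕ
        n = length wm

        h : GTV r → ℕ
        h = parentPotential c γ wm

        h-lipschitz : LipschitzOn (_≢ node c (γ ∷ wm) p) h
        h-lipschitz = parentPotential-lipschitz p

        parent y : GTV r
        parent = node c wm (<⇒≤ p)
        y = node (not c) (γ ∷ wm) p′

        h-y : h y ≡ opposite n + suc n
        h-y = trans (parentPotential-inside {c} {γ} {wm} {y} (here (≡⇒Pointwise-≡ refl)))
                    (cong (opposite n +_) (coord-here {not c} (γ ∷ wm) p′))

        y≢x : y ≢ node c (γ ∷ wm) p
        y≢x eq = not-¬ refl (sym (node-copy eq))

        ℓ : Σ (Vec Bool r) λ v → Vec.toList v ≡ false ∷ γ ∷ wm
        ℓ = vector-of (false ∷ γ ∷ wm) above-leaves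

        walk : Walk y parent
        walk = inj₁ (node-leaf (not c) (γ ∷ wm) false p′ (proj₁ ℓ) (proj₂ ℓ))
             ∷ inj₂ (node-leaf c (γ ∷ wm) false p (proj₁ ℓ) (proj₂ ℓ))
             ∷ inj₂ (node-node c wm γ (<⇒≤ p) p) ∷ []

        avoiding-x : h y ≤ len walk + h parent
        avoiding-x = outer-lipschitz-bound _≟ᵥ_ outer x∈S y∈S h-lipschitz y≢x parent≢child walk

  code : GTV r → List Bool
  code (leaf v) = Vec.toList v
  code (node c w _) = c ∷ w ++ replicate (r ∸ suc (length w)) true

  length-code : ∀ z → length (code z) ≡ r
  length-code (leaf v) = length-leaf v
  length-code (node c w p) = begin
    suc (length (w ++ replicate k true))  ≡⟨ cong suc (length-++ w) ⟩
    suc (length w + length (replicate k true))  ≡⟨ cong (λ l → suc (length w + l)) (length-replicate k) ⟩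
    suc (length w) + k                    ≡⟨ m+[n∸m]≡n p ⟩
    r                                     ∎
    where
      open ≡-Reasoning
      k : ℕ
      k = r ∸ suc (length w)

  code-above-leaves : ∀ {c w} (p : length w < r) → suc (length w) ≡ r → code (node c w p) ≡ c ∷ w
  code-above-leaves {c} {w} _ above-leaves = trans (cong (λ k → c ∷ w ++ replicate k true) no-padding)
                                                   (cong (c ∷_) (++-identityʳ w))
    where
      no-padding : r ∸ suc (length w) ≡ 0
      no-padding = trans (cong (_∸ suc (length w)) (sym above-leaves)) (n∸n≡0 (suc (length w)))

  code-copy : ∀ {c l} z → code z ≡ c ∷ l → InCopy c z
  code-copy (leaf _) _ = inLeaf
  code-copy (node _ _ _) refl = inNode

  _≟ʷ_ : DecidableEquality (List Bool)
  _≟ʷ_ = List.≡-dec Bool._≟_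

  words : List (List Bool)
  words = map Vec.toList (vectors r)

  length-words : length words ≡ 2 ^ r
  length-words = trans (length-map Vec.toList (vectors r)) (length-vectors r)

  word∈words : ∀ l → length l ≡ r → l ∈ words
  word∈words l e with v , refl ← vector-of l e = ∈-map⁺ Vec.toList (∈-vectors v)

  codes⊆words : ∀ S → map code S ⊆ words
  codes⊆words S l∈ with z , _ , refl ← ∈-map⁻ code l∈ = word∈words (code z) (length-code z)

  module _ (2≤r : 2 ≤ r) {S : List (GTV r)} (outer : IsOuterMutualVisibilitySet S) where

    leaf-child-not-member : ∀ {c w p v β} → node c w p ∈ S → leaf v ∈ S →
                            pos (leaf v) ≡ β ∷ w → ⊥
    leaf-child-not-member {w = []} _ _ e = <-irrefl (leaf-depth e) 2≤r
    leaf-child-not-member {w = _ ∷ _} = leaf-child-separates outer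

    twin-not-member : ∀ {c w p p′} → suc (length w) ≡ r →
                      node c w p ∈ S → node (not c) w p′ ∈ S → ⊥
    twin-not-member {w = []} above-leaves _ _ = <-irrefl above-leaves 2≤r
    twin-not-member {w = _ ∷ _} = twin-separates outer

    node-code-injective : ∀ {c w p b} → node c w p ∈ S → b ∈ S → code (node c w p) ≡ code b →
                          node c w p ≡ b
    node-code-injective {c} {w} {p} {b} x∈S b∈S e with m≤n⇒m<n∨m≡n p
    ... | inj₁ deep = sym (deep-member-alone outer deep x∈S b∈S (code-copy b (sym e)))
    ... | inj₂ above-leaves =
      same-code b∈S (code-copy b (sym e)) (trans (sym (code-above-leaves p above-leaves)) e)
      where
        same-code : ∀ {b} → b ∈ S → InCopy c b → c ∷ w ≡ code b → node c w p ≡ b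
        same-code b∈S inLeaf e′ = ⊥-elim (leaf-child-not-member x∈S b∈S (sym e′))
        same-code {node _ w′ p′} b∈S inNode e′ with m≤n⇒m<n∨m≡n p′
        ... | inj₁ deep′ = deep-member-alone outer deep′ b∈S x∈S inNode
        ... | inj₂ above-leaves′
          with refl ← List.∷-injectiveʳ (trans e′ (code-above-leaves p′ above-leaves′)) = node-≡ p p′

    code-injective : ∀ {a b} → a ∈ S → b ∈ S → code a ≡ code b → a ≡ b
    code-injective {node _ _ _} a∈S b∈S e = node-code-injective a∈S b∈S e
    code-injective {leaf _} {node _ _ _} a∈S b∈S e = sym (node-code-injective b∈S a∈S (sym e))
    code-injective {leaf v} {leaf _} _ _ e = leaf-pos-injective e (≤-reflexive (sym (length-leaf v)))

    codes-unique : Unique S → Unique (map code S)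
    codes-unique = map-unique code code-injective

    length-≤ : Unique S → length S ≤ 2 ^ r
    length-≤ uS = begin
      length S             ≡⟨ length-map code S ⟨
      length (map code S)  ≤⟨ unique-⊆⇒length-≤ _≟ʷ_ (codes-unique uS) (codes⊆words S) ⟩
      length words         ≡⟨ length-words ⟩
      2 ^ r                ∎
      where open ≤-Reasoning

    module _ (uS : Unique S) (size : length S ≡ 2 ^ r) where

      words⊆codes : words ⊆ map code S
      words⊆codes = unique-⊆-length-≥⇒⊇ _≟ʷ_ (codes-unique uS) (codes⊆words S)
        (≤-reflexive (trans length-words (sym (trans (length-map code S) size))))

      code-onto : ∀ l → length l ≡ r → Σ (GTV r) λ b → b ∈ S × code b ≡ l
      code-onto l e with b , b∈S , refl ← ∈-map⁻ code (words⊆codes (word∈words l e)) = b , b∈S , refl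

      no-deep-member : ∀ {c w p} → node c w p ∈ S → suc (length w) < r → ⊥
      no-deep-member {c} {w} {p} x∈S deep =
        false≢true (List.∷-injectiveˡ (List.∷-injectiveʳ (trans (sym (code-x false)) (code-x true))))
        where
          word : Bool → List Bool
          word β = c ∷ β ∷ replicate (r ∸ 2) true

          length-word : ∀ β → length (word β) ≡ r
          length-word β = trans (cong (λ k → suc (suc k)) (length-replicate (r ∸ 2))) (m+[n∸m]≡n 2≤r)

          code-x : ∀ β → code (node c w p) ≡ word β
          code-x β with b , b∈S , e ← code-onto (word β) (length-word β) =
            trans (cong code (sym (deep-member-alone outer deep x∈S b∈S (code-copy b e)))) e

      no-member-above-leaves : ∀ {c w p} → node c w p ∈ S → suc (length w) ≡ r → ⊥
      no-member-above-leaves {c} {w} {p} x∈S above-leaves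
        with b , b∈S , e ← code-onto (not c ∷ w) above-leaves = twin-code b∈S e
        where
          twin-code : ∀ {b} → b ∈ S → code b ≡ not c ∷ w → ⊥
          twin-code {leaf _} b∈S e = leaf-child-not-member x∈S b∈S e
          twin-code {node _ w′ p′} b∈S e with refl ← List.∷-injectiveˡ e | m≤n⇒m<n∨m≡n p′
          ... | inj₁ deep′ = no-deep-member b∈S deep′
          ... | inj₂ above-leaves′
            with refl ← List.∷-injectiveʳ (trans (sym (code-above-leaves p′ above-leaves′)) e) =
            twin-not-member above-leaves x∈S b∈S

      members-are-leaves : ∀ {z} → z ∈ S → Σ (Vec Bool r) λ v → z ≡ leaf v
      members-are-leaves {leaf v} _ = v , refl
      members-are-leaves {node _ _ p} z∈S with m≤n⇒m<n∨m≡n p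
      ... | inj₁ deep = ⊥-elim (no-deep-member z∈S deep)
      ... | inj₂ above-leaves = ⊥-elim (no-member-above-leaves z∈S above-leaves)

      same-as-leaves : SameSet leaves S
      same-as-leaves z = mk⇔ to from
        where
          to : z ∈ leaves → z ∈ S
          to z∈leaves
            with v , _ , refl ← ∈-map⁻ leaf z∈leaves
            with b , b∈S , e ← code-onto (Vec.toList v) (length-leaf v)
            with v′ , refl ← members-are-leaves b∈S =
            subst (_∈ S) (leaf-pos-injective e (≤-reflexive (sym (length-leaf v′)))) b∈S

          from : z ∈ S → z ∈ leaves
          from z∈S with v , refl ← members-are-leaves z∈S = leaf∈leaves v

mainTheorem4 : (r : ℕ) → 2 ≤ r →
    GraphNotions.μo≡ (GTAdj r) (2 ^ r) × GraphNotions.UniqueμoSet (GTAdj r) (2 ^ r)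
mainTheorem4 r 2≤r =
  ( (leaves , leaves-unique , leaves-outer , length-leaves)
  , λ S uS outer → length-≤ 2≤r outer uS )
  , ( leaves , (leaves-unique , leaves-outer , length-leaves)
    , λ S (uS , outer , size) → same-as-leaves 2≤r outer uS size )
  where open GluedTree r
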